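{- Let $d\ge1$ be an integer, $B=\lfloor d/2\rfloor$, and fix an integer $\ell$ with $0\le\ell\le d-1$. Define $s,g:\{0,1,\dots,d\}\to\mathbb{Z}$ by $s(i)=d-2i+1$ and \[ g(i)=\sum_{\substack{I\subseteq\{0,1,\dots,d-1\}\\ |I|=d-\ell}}\ \prod_{k\in I}(B+d-i-k). \] Set $\lambda(\ell)=\tfrac12\big(g(B)-g(B+1)\big)$. Then \[ \lambda(\ell)=\frac d2\sum_{\substack{I\subseteq\{1,\dots,d-1\}\\ |I|=d-\ell-1}}\ \prod_{k\in I}(d-k)\ >\ 0, \] and $g(i)\ge \lambda(\ell)\,s(i)$ for all $i=0,1,\dots,d$. -}

module Defs where

open import Data.Nat as ℕ using (ℕ; zero; suc; ⌊_/2⌋)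
open import Data.Integer as ℤ using (ℤ; +_)
open import Data.List using (List; []; _∷_; map; _++_; upTo; foldr; drop)
open import Data.Rational as ℚ using (ℚ; ½)

subsetsOfSize : {A : Set} → ℕ → List A → List (List A)
subsetsOfSize zero    _        = [] ∷ []
subsetsOfSize (suc m) []       = []
subsetsOfSize (suc m) (x ∷ xs) = map (x ∷_) (subsetsOfSize m xs) ++ subsetsOfSize (suc m) xs

sumℤ : List ℤ → ℤ
sumℤ = foldr ℤ._+_ (+ 0)

prodℤ : List ℤ → ℤ
prodℤ = foldr ℤ._*_ (+ 1)

sumProdSubsets : (ℕ → ℤ) → ℕ → List ℕ → ℤ
sumProdSubsets f m ks = sumℤ (map (λ I → prodℤ (map f I)) (subsetsOfSize m ks))

B : ℕ → ℕ
B d = ⌊ d /2⌋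

s : ℕ → ℕ → ℤ
s d i = (+ d ℤ.- + (2 ℕ.* i)) ℤ.+ + 1

g : ℕ → ℕ → ℕ → ℤ
g d ℓ i = sumProdSubsets (λ k → + (B d ℕ.+ d) ℤ.- + i ℤ.- + k) (d ℕ.∸ ℓ) (upTo d)

lam : ℕ → ℕ → ℚ
lam d ℓ = ½ ℚ.* ((g d ℓ (B d) ℤ.- g d ℓ (suc (B d))) ℚ./ 1)

rhs : ℕ → ℕ → ℚ
rhs d ℓ = (+ d ℚ./ 2) ℚ.* (sumProdSubsets (λ k → + d ℤ.- + k) (d ℕ.∸ ℓ ℕ.∸ 1) (drop 1 (upTo d)) ℚ./ 1)

{-# OPTIONS --safe #-}

-- With e_k the elementary symmetric functions, m + 1 = d - ℓ and the run
-- R(c, p) = (c, c - 1, …, c - p + 1), we have g(i) = e_{m+1}(R(B + d - i, d)).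
-- Shifting a run by one changes e_{m+1} by d · e_m of the common part, so
-- g(i) - g(i+1) = d · e_m(R(B + d - i - 1, d - 1)); at i = B this run is d-1, …, 1,
-- whence λ = d h / 2 with h = e_m(d-1, …, 1) > 0.  The slack 2 g(i) - 2 λ s(i)
-- therefore changes by 2 d (e_m(R(B + d - i - 1, d - 1)) - h) from i to i + 1.
-- For i ≤ B the run is positive and dominates d-1, …, 1 entrywise, so the slack
-- decreases up to B + 1; for i > B the run crosses zero, and once its negative
-- entries are moved to the front its absolute values are dominated by d-1, …, 1
-- (this is where 2B ≥ d - 1 enters), so the slack increases from B + 1 on.
-- At the bottom, the slack equals 2 g(B+1) + 2 λ (2B + 1 - d) ≥ 0.

module Submission where

open import Defs
open import Data.Nat.Base as ℕ using (ℕ; zero; suc; z≤n; s≤s; _≤_; _<_; _≤′_; ≤′-reflexive; ≤′-step)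
import Data.Nat.Properties as ℕ
open import Data.Integer.Base as ℤ using (ℤ; +_; -[1+_]; ∣_∣; 0ℤ; 1ℤ; -1ℤ; -_; _+_; _*_; _-_; +≤+; +<+)
import Data.Integer.Properties as ℤ
open import Data.Integer.Tactic.RingSolver using (solve-∀)
open import Data.List.Base using (List; []; _∷_; _∷ʳ_; _++_; map; upTo; applyUpTo; length; drop)
import Data.List.Properties as List
open import Data.List.Relation.Unary.All as All using (All; []; _∷_)
open import Data.List.Relation.Binary.Pointwise as Pointwise using (Pointwise; []; _∷_)
open import Data.List.Relation.Binary.Permutation.Propositional using (_↭_; prep; swap; ↭-sym)
import Data.List.Relation.Binary.Permutation.Propositional as ↭
import Data.List.Relation.Binary.Permutation.Propositional.Properties as ↭
open import Data.Rational.Base as ℚ using (_/_; 0ℚ; ½; toℚᵘ) renaming (_≤_ to _≤ℚ_; _<_ to _<ℚ_)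
import Data.Rational.Properties as ℚ
open import Data.Rational.Unnormalised.Base as ℚᵘ using (mkℚᵘ; *≤*)
import Data.Rational.Unnormalised.Properties as ℚᵘ
open import Data.Product.Base using (_×_; _,_)
open import Data.Sum.Base using (inj₁; inj₂)
open import Relation.Binary.PropositionalEquality

esym : ℕ → List ℤ → ℤ
esym zero    _        = 1ℤ
esym (suc m) []       = 0ℤ
esym (suc m) (x ∷ xs) = x * esym m xs + esym (suc m) xs

esymℕ : ℕ → List ℕ → ℕ
esymℕ zero    _        = 1
esymℕ (suc m) []       = 0
esymℕ (suc m) (x ∷ xs) = x ℕ.* esymℕ m xs ℕ.+ esymℕ (suc m) xs

sumProdSubsets≡esym : ∀ f m ks → sumProdSubsets f m ks ≡ esym m (map f ks)
sumProdSubsets≡esym f zero    ks       = refl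
sumProdSubsets≡esym f (suc m) []       = refl
sumProdSubsets≡esym f (suc m) (k ∷ ks) = begin
  sumℤ (map Π (map (k ∷_) (subsetsOfSize m ks) ++ subsetsOfSize (suc m) ks))
    ≡⟨ cong sumℤ (List.map-++ Π (map (k ∷_) (subsetsOfSize m ks)) _) ⟩
  sumℤ (map Π (map (k ∷_) (subsetsOfSize m ks)) ++ map Π (subsetsOfSize (suc m) ks))
    ≡⟨ sumℤ-++ (map Π (map (k ∷_) (subsetsOfSize m ks))) _ ⟩
  sumℤ (map Π (map (k ∷_) (subsetsOfSize m ks))) + sumProdSubsets f (suc m) ks
    ≡⟨ cong₂ _+_ (sum-with-k (subsetsOfSize m ks)) (sumProdSubsets≡esym f (suc m) ks) ⟩
  f k * sumProdSubsets f m ks + esym (suc m) (map f ks)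
    ≡⟨ cong (λ e → f k * e + esym (suc m) (map f ks)) (sumProdSubsets≡esym f m ks) ⟩
  esym (suc m) (map f (k ∷ ks)) ∎
  where
  open ≡-Reasoning
  Π : List ℕ → ℤ
  Π I = prodℤ (map f I)

  sumℤ-++ : ∀ xs ys → sumℤ (xs ++ ys) ≡ sumℤ xs + sumℤ ys
  sumℤ-++ []       ys = sym (ℤ.+-identityˡ (sumℤ ys))
  sumℤ-++ (x ∷ xs) ys = trans (cong (λ s → x + s) (sumℤ-++ xs ys)) (sym (ℤ.+-assoc x _ _))

  sum-with-k : ∀ Is → sumℤ (map Π (map (k ∷_) Is)) ≡ f k * sumℤ (map Π Is)
  sum-with-k []       = sym (ℤ.*-zeroʳ (f k))
  sum-with-k (I ∷ Is) = trans (cong (λ s → f k * Π I + s) (sum-with-k Is)) (sym (ℤ.*-distribˡ-+ (f k) _ _))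

esym-↭ : ∀ {xs ys} → xs ↭ ys → ∀ m → esym m xs ≡ esym m ys
esym-↭ ↭.refl           m             = refl
esym-↭ (↭.trans p q)    m             = trans (esym-↭ p m) (esym-↭ q m)
esym-↭ (prep x p)       zero          = refl
esym-↭ (prep x p)       (suc m)       = cong₂ (λ e f → x * e + f) (esym-↭ p m) (esym-↭ p (suc m))
esym-↭ (swap x y p)     zero          = refl
esym-↭ (swap x y p)     (suc zero)    rewrite esym-↭ p 1 = exchange₁ x y _
  where
  exchange₁ : ∀ x y a → x * 1ℤ + (y * 1ℤ + a) ≡ y * 1ℤ + (x * 1ℤ + a)
  exchange₁ = solve-∀
esym-↭ (swap x y p)     (suc (suc m))
  rewrite esym-↭ p m | esym-↭ p (suc m) | esym-↭ p (suc (suc m)) = exchange₂ x y _ _ _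
  where
  exchange₂ : ∀ x y a b c → x * (y * a + b) + (y * b + c) ≡ y * (x * a + b) + (x * b + c)
  exchange₂ = solve-∀

esym-∷ʳ : ∀ m xs y → esym (suc m) (xs ∷ʳ y) ≡ y * esym m xs + esym (suc m) xs
esym-∷ʳ m xs y = esym-↭ (↭-sym (↭.∷↭∷ʳ y xs)) (suc m)

∣esym∣≤esymℕ∣∣ : ∀ m xs → ∣ esym m xs ∣ ℕ.≤ esymℕ m (map ∣_∣ xs)
∣esym∣≤esymℕ∣∣ zero    xs       = ℕ.≤-refl
∣esym∣≤esymℕ∣∣ (suc m) []       = ℕ.≤-refl
∣esym∣≤esymℕ∣∣ (suc m) (x ∷ xs) = ℕ.≤-trans (ℤ.∣i+j∣≤∣i∣+∣j∣ (x * esym m xs) _)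
  (ℕ.+-mono-≤ (ℕ.≤-trans (ℕ.≤-reflexive (ℤ.∣i*j∣≡∣i∣*∣j∣ x _)) (ℕ.*-monoʳ-≤ ∣ x ∣ (∣esym∣≤esymℕ∣∣ m xs)))
              (∣esym∣≤esymℕ∣∣ (suc m) xs))

esymℕ-mono : ∀ m {xs ys} → Pointwise ℕ._≤_ xs ys → esymℕ m xs ℕ.≤ esymℕ m ys
esymℕ-mono zero    _          = ℕ.≤-refl
esymℕ-mono (suc m) []         = ℕ.≤-refl
esymℕ-mono (suc m) (x≤y ∷ ps) = ℕ.+-mono-≤ (ℕ.*-mono-≤ x≤y (esymℕ-mono m ps)) (esymℕ-mono (suc m) ps)

esym-of-nonNeg : ∀ m {xs} → All (0ℤ ℤ.≤_) xs → esym m xs ≡ + esymℕ m (map ∣_∣ xs)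
esym-of-nonNeg zero    _                = refl
esym-of-nonNeg (suc m) []               = refl
esym-of-nonNeg (suc m) {+ x ∷ xs} (_ ∷ ps) = cong₂ _+_
  (trans (cong (+ x *_) (esym-of-nonNeg m ps)) (sym (ℤ.pos-* x _))) (esym-of-nonNeg (suc m) ps)

esym-nonNeg : ∀ m {xs} → All (0ℤ ℤ.≤_) xs → 0ℤ ℤ.≤ esym m xs
esym-nonNeg m 0≤xs = subst (0ℤ ℤ.≤_) (sym (esym-of-nonNeg m 0≤xs)) (+≤+ z≤n)

_≼_ : ℤ → ℤ → Set
x ≼ y = ∣ x ∣ ℕ.≤ ∣ y ∣

esym-≤-dominated : ∀ m {xs ys} → Pointwise _≼_ xs ys → All (0ℤ ℤ.≤_) ys →
                   esym m xs ℤ.≤ esym m ys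
esym-≤-dominated m {xs} {ys} xs≼ys 0≤ys = begin
  esym m xs                     ≤⟨ i≤+∣i∣ (esym m xs) ⟩
  + ∣ esym m xs ∣               ≤⟨ +≤+ (∣esym∣≤esymℕ∣∣ m xs) ⟩
  + esymℕ m (map ∣_∣ xs)        ≤⟨ +≤+ (esymℕ-mono m (Pointwise.map⁺ ∣_∣ ∣_∣ xs≼ys)) ⟩
  + esymℕ m (map ∣_∣ ys)        ≡⟨ esym-of-nonNeg m 0≤ys ⟨
  esym m ys                     ∎
  where
  open ℤ.≤-Reasoning
  i≤+∣i∣ : ∀ i → i ℤ.≤ + ∣ i ∣
  i≤+∣i∣ (+ _)    = ℤ.≤-refl
  i≤+∣i∣ -[1+ _ ] = ℤ.-≤+

esym-pos : ∀ m {xs} → All (0ℤ ℤ.<_) xs → m ℕ.≤ length xs → 0ℤ ℤ.< esym m xs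
esym-pos zero    _                          _            = +<+ (s≤s z≤n)
esym-pos (suc m) {x ∷ xs} (0<x ∷ 0<xs) (s≤s m≤∣xs∣) =
  ℤ.+-mono-<-≤ 0<x*e (esym-nonNeg (suc m) (All.map ℤ.<⇒≤ 0<xs))
  where
  0<x*e : 0ℤ ℤ.< x * esym m xs
  0<x*e = subst (ℤ._< x * esym m xs) (ℤ.*-zeroʳ x)
            (ℤ.*-monoˡ-<-pos x {{ℤ.positive 0<x}} (esym-pos m 0<xs m≤∣xs∣))

countdown : ℤ → ℕ → List ℤ
countdown x zero    = []
countdown x (suc n) = x ∷ countdown (ℤ.pred x) n

length-countdown : ∀ x n → length (countdown x n) ≡ n
length-countdown x zero    = refl
length-countdown x (suc n) = cong suc (length-countdown (ℤ.pred x) n)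

applyUpTo-countdown : ∀ x n (f : ℕ → ℤ) → (∀ k → f k ≡ x - + k) → applyUpTo f n ≡ countdown x n
applyUpTo-countdown x zero    f f≗ = refl
applyUpTo-countdown x (suc n) f f≗ = cong₂ _∷_ (trans (f≗ 0) (ℤ.+-identityʳ x))
  (applyUpTo-countdown (ℤ.pred x) n (λ k → f (suc k)) (λ k → trans (f≗ (suc k)) (shift x (+ k))))
  where
  shift : ∀ x k → x - (1ℤ + k) ≡ (- 1ℤ + x) - k
  shift = solve-∀

countdown-∷ʳ : ∀ x n → countdown x (suc n) ≡ countdown x n ∷ʳ (x - + n)
countdown-∷ʳ x zero    = cong (_∷ []) (sym (ℤ.+-identityʳ x))
countdown-∷ʳ x (suc n) = cong (x ∷_)
  (trans (countdown-∷ʳ (ℤ.pred x) n) (cong (countdown (ℤ.pred x) n ∷ʳ_) (shift x (+ n))))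
  where
  shift : ∀ x k → (- 1ℤ + x) - k ≡ x - (1ℤ + k)
  shift = solve-∀

esym-countdown-shift : ∀ m n x →
  esym (suc m) (countdown x (suc n)) ≡
  esym (suc m) (countdown (ℤ.pred x) (suc n)) + + suc n * esym m (countdown (ℤ.pred x) n)
esym-countdown-shift m n x = begin
  x * e + f                                    ≡⟨ regroup x (+ n) e f ⟩
  ((ℤ.pred x - + n) * e + f) + + suc n * e     ≡⟨ cong (_+ + suc n * e) (esym-∷ʳ m xs (ℤ.pred x - + n)) ⟨
  esym (suc m) (xs ∷ʳ (ℤ.pred x - + n)) + + suc n * e
    ≡⟨ cong (λ ys → esym (suc m) ys + + suc n * e) (countdown-∷ʳ (ℤ.pred x) n) ⟨
  esym (suc m) (countdown (ℤ.pred x) (suc n)) + + suc n * e ∎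
  where
  open ≡-Reasoning
  xs = countdown (ℤ.pred x) n
  e  = esym m xs
  f  = esym (suc m) xs
  regroup : ∀ x n e f → x * e + f ≡ (((- 1ℤ + x) - n) * e + f) + (1ℤ + n) * e
  regroup = solve-∀

countdown-nonNeg : ∀ {a p} → p ℕ.≤ suc a → All (0ℤ ℤ.≤_) (countdown (+ a) p)
countdown-nonNeg {_}     {zero}        _         = []
countdown-nonNeg {_}     {suc zero}    _         = +≤+ z≤n ∷ []
countdown-nonNeg {suc a} {suc (suc p)} (s≤s p<a) = +≤+ z≤n ∷ countdown-nonNeg p<a

countdown-pos : ∀ {a p} → p ℕ.≤ a → All (0ℤ ℤ.<_) (countdown (+ a) p)
countdown-pos {_}     {zero}  _         = []
countdown-pos {suc a} {suc p} (s≤s p≤a) = +<+ (s≤s z≤n) ∷ countdown-pos p≤a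

countdown-≼ : ∀ {a a′ p} → a ℕ.≤ a′ → p ℕ.≤ suc a → Pointwise _≼_ (countdown (+ a) p) (countdown (+ a′) p)
countdown-≼ {_}     {_}      {zero}        _          _         = []
countdown-≼ {_}     {_}      {suc zero}    a≤a′       _         = a≤a′ ∷ []
countdown-≼ {suc a} {suc a′} {suc (suc p)} (s≤s a≤a′) (s≤s p<a) = s≤s a≤a′ ∷ countdown-≼ a≤a′ p<a

countdown-neg-≼ : ∀ a b k → a ℕ.+ b ℕ.+ b ℕ.≤ suc k →
                  Pointwise _≼_ (countdown -[1+ a ] b) (countdown (+ k) b)
countdown-neg-≼ a zero    k       _  = []
countdown-neg-≼ a (suc b) k       le
  with subst (ℕ._≤ suc k) (trans (cong (ℕ._+ suc b) (ℕ.+-suc a b)) (cong suc (ℕ.+-suc (a ℕ.+ b) b))) le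
countdown-neg-≼ a (suc b) (suc k) le | s≤s (s≤s a+2b≤k) =
  s≤s (ℕ.≤-trans (ℕ.≤-trans (ℕ.m≤m+n a b) (ℕ.m≤m+n (a ℕ.+ b) b)) a+2b≤k)
  ∷ countdown-neg-≼ (suc a) b k (s≤s a+2b≤k)

countdown-crossing : ∀ c b → countdown (+ c) (suc c ℕ.+ b) ≡ countdown (+ c) (suc c) ++ countdown -1ℤ b
countdown-crossing zero    b = refl
countdown-crossing (suc c) b = cong (+ suc c ∷_) (countdown-crossing c b)

countdown-++ : ∀ p k q → countdown (+ (p ℕ.+ k)) (p ℕ.+ q) ≡ countdown (+ (p ℕ.+ k)) p ++ countdown (+ k) q
countdown-++ zero    k q = refl
countdown-++ (suc p) k q = cong (+ suc (p ℕ.+ k) ∷_) (countdown-++ p k q)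

esym-countdown-mono : ∀ m {a a′ p} → a ℕ.≤ a′ → p ℕ.≤ suc a →
                      esym m (countdown (+ a) p) ℤ.≤ esym m (countdown (+ a′) p)
esym-countdown-mono m a≤a′ p≤1+a =
  esym-≤-dominated m (countdown-≼ a≤a′ p≤1+a) (countdown-nonNeg (ℕ.≤-trans p≤1+a (s≤s a≤a′)))

esym-countdown-crossing-≤ : ∀ m c b {n} → suc c ℕ.+ b ≡ n → b ℕ.≤ 2 ℕ.+ c →
                            esym m (countdown (+ c) n) ℤ.≤ esym m (countdown (+ n) n)
esym-countdown-crossing-≤ m c b refl b≤2+c = begin
  esym m (countdown (+ c) (suc c ℕ.+ b))                 ≡⟨ cong (esym m) (countdown-crossing c b) ⟩
  esym m (countdown (+ c) (suc c) ++ countdown -1ℤ b)    ≡⟨ esym-↭ (↭.++-comm (countdown (+ c) (suc c)) _) m ⟩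
  esym m (countdown -1ℤ b ++ countdown (+ c) (suc c))    ≤⟨ esym-≤-dominated m negatives-first 0≤target ⟩
  esym m (countdown (+ n′) b ++ countdown (+ suc c) (suc c))
    ≡⟨ cong (esym m) (countdown-++ b (suc c) (suc c)) ⟨
  esym m (countdown (+ n′) n′)
    ≡⟨ cong (λ k → esym m (countdown (+ k) k)) (ℕ.+-comm b (suc c)) ⟩
  esym m (countdown (+ (suc c ℕ.+ b)) (suc c ℕ.+ b))     ∎
  where
  open ℤ.≤-Reasoning
  n′ = b ℕ.+ suc c
  negatives-first : Pointwise _≼_ (countdown -1ℤ b ++ countdown (+ c) (suc c))
                                  (countdown (+ n′) b ++ countdown (+ suc c) (suc c))
  negatives-first = Pointwise.++⁺
    (countdown-neg-≼ 0 b n′ (ℕ.≤-trans (ℕ.+-monoʳ-≤ b b≤2+c) (ℕ.≤-reflexive (ℕ.+-suc b (suc c)))))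
    (countdown-≼ (ℕ.n≤1+n c) ℕ.≤-refl)
  0≤target : All (0ℤ ℤ.≤_) (countdown (+ n′) b ++ countdown (+ suc c) (suc c))
  0≤target = subst (All (0ℤ ℤ.≤_)) (countdown-++ b (suc c) (suc c)) (countdown-nonNeg (ℕ.n≤1+n n′))

valley-bottom-≤ : (F : ℕ → ℤ) {b N : ℕ} →
                  (∀ {i} → i ℕ.< b → F (suc i) ℤ.≤ F i) →
                  (∀ {i} → b ℕ.≤ i → i ℕ.< N → F i ℤ.≤ F (suc i)) →
                  ∀ {i} → i ℕ.≤ N → F b ℤ.≤ F i
valley-bottom-≤ F {b} {N} down up {i} i≤N with ℕ.≤-total i b
... | inj₁ i≤b = descend (ℕ.≤⇒≤′ i≤b) ℕ.≤-refl
  where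
  descend : ∀ {k} → i ≤′ k → k ℕ.≤ b → F k ℤ.≤ F i
  descend (≤′-reflexive refl) _     = ℤ.≤-refl
  descend (≤′-step i≤′k)      k<b = ℤ.≤-trans (down k<b) (descend i≤′k (ℕ.<⇒≤ k<b))
... | inj₂ b≤i = ascend (ℕ.≤⇒≤′ b≤i) i≤N
  where
  ascend : ∀ {k} → b ≤′ k → k ℕ.≤ N → F b ℤ.≤ F k
  ascend (≤′-reflexive refl) _     = ℤ.≤-refl
  ascend (≤′-step b≤′k)      k<N = ℤ.≤-trans (ascend b≤′k (ℕ.<⇒≤ k<N)) (up (ℕ.≤′⇒≤ b≤′k) k<N)

*-nonNeg : ∀ i j → 0ℤ ℤ.≤ i → 0ℤ ℤ.≤ j → 0ℤ ℤ.≤ i * j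
*-nonNeg (+ a) (+ b) _ _ = subst (0ℤ ℤ.≤_) (ℤ.pos-* a b) (+≤+ z≤n)

s-suc : ∀ d i → s d i ≡ s d (suc i) + + 2
s-suc d i = begin
  (+ d - + (2 ℕ.* i)) + 1ℤ                 ≡⟨ cong (λ t → (+ d - t) + 1ℤ) (ℤ.pos-* 2 i) ⟩
  (+ d - + 2 * + i) + 1ℤ                   ≡⟨ shift (+ d) (+ i) ⟩
  ((+ d - + 2 * + suc i) + 1ℤ) + + 2       ≡⟨ cong (λ t → (+ d - t) + 1ℤ + + 2) (ℤ.pos-* 2 (suc i)) ⟨
  s d (suc i) + + 2                        ∎
  where
  open ≡-Reasoning
  shift : ∀ d i → (d - + 2 * i) + 1ℤ ≡ ((d - + 2 * (1ℤ + i)) + 1ℤ) + + 2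
  shift = solve-∀

-- With d = suc n and m + 1 = d - ℓ, G is the paper's g, h the sum in λ(ℓ), and D = 2 λ(ℓ).
module RunSums (n m B : ℕ) where

  start : ℕ → ℤ
  start i = + (B ℕ.+ suc n) - + i

  G : ℕ → ℤ
  G i = esym (suc m) (countdown (start i) (suc n))

  slope : ℕ → ℤ
  slope i = esym m (countdown (start (suc i)) n)

  h : ℤ
  h = esym m (countdown (+ n) n)

  D : ℤ
  D = + suc n * h

  start-suc : ∀ i → start (suc i) ≡ ℤ.pred (start i)
  start-suc i = shift (+ (B ℕ.+ suc n)) (+ i)
    where
    shift : ∀ a i → a - (1ℤ + i) ≡ - 1ℤ + (a - i)
    shift = solve-∀

  G-step : ∀ i → G i ≡ G (suc i) + + suc n * slope i
  G-step i = subst (λ y → G i ≡ esym (suc m) (countdown y (suc n)) + + suc n * esym m (countdown y n))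
                   (sym (start-suc i)) (esym-countdown-shift m n (start i))

  start-suc-B : start (suc B) ≡ + n
  start-suc-B = cancel (+ B) (+ n)
    where
    cancel : ∀ b n → (b + (1ℤ + n)) - (1ℤ + b) ≡ n
    cancel = solve-∀

  G-drop : G B - G (suc B) ≡ D
  G-drop = begin
    G B - G (suc B)                              ≡⟨ cong (_- G (suc B)) (G-step B) ⟩
    (G (suc B) + + suc n * slope B) - G (suc B)  ≡⟨ cancel (G (suc B)) _ ⟩
    + suc n * slope B                            ≡⟨ cong (λ y → + suc n * esym m (countdown y n)) start-suc-B ⟩
    D                                            ∎
    where
    open ≡-Reasoning
    cancel : ∀ a x → (a + x) - a ≡ x
    cancel = solve-∀

  h≤slope : ∀ {i} → i ℕ.≤ B → h ℤ.≤ slope i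
  h≤slope {i} i≤B with ℕ.m≤n⇒∃[o]m+o≡n i≤B
  ... | k , i+k≡B = subst (λ y → h ℤ.≤ esym m (countdown y n)) (sym start≡)
                          (esym-countdown-mono m (ℕ.m≤n+m n k) (ℕ.n≤1+n n))
    where
    cancel : ∀ i k n → ((i + k) + (1ℤ + n)) - (1ℤ + i) ≡ k + n
    cancel = solve-∀
    start≡ : start (suc i) ≡ + (k ℕ.+ n)
    start≡ = trans (cong (λ b → + (b ℕ.+ suc n) - + suc i) (sym i+k≡B)) (cancel (+ i) (+ k) (+ n))

  slope≤h : n ℕ.≤ B ℕ.+ B → ∀ {i} → B ℕ.< i → i ℕ.≤ n → slope i ℤ.≤ h
  slope≤h n≤2B {i} B<i i≤n with ℕ.m≤n⇒∃[o]m+o≡n B<i | ℕ.m≤n⇒∃[o]m+o≡n i≤n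
  ... | j , 1+B+j≡i | r , i+r≡n =
    subst (λ y → esym m (countdown y n) ℤ.≤ h) (sym start≡)
          (esym-countdown-crossing-≤ m (B ℕ.+ r) j n≡ j≤2+c)
    where
    cancel : ∀ b i r → (b + (1ℤ + (i + r))) - (1ℤ + i) ≡ b + r
    cancel = solve-∀
    start≡ : start (suc i) ≡ + (B ℕ.+ r)
    start≡ = trans (cong (λ k → + (B ℕ.+ suc k) - + suc i) (sym i+r≡n)) (cancel (+ B) (+ i) (+ r))
    n≡ : suc (B ℕ.+ r) ℕ.+ j ≡ n
    n≡ = begin
      suc (B ℕ.+ r ℕ.+ j)   ≡⟨ cong suc (ℕ.+-assoc B r j) ⟩
      suc (B ℕ.+ (r ℕ.+ j)) ≡⟨ cong (λ t → suc (B ℕ.+ t)) (ℕ.+-comm r j) ⟩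
      suc (B ℕ.+ (j ℕ.+ r)) ≡⟨ cong suc (ℕ.+-assoc B j r) ⟨
      suc B ℕ.+ j ℕ.+ r     ≡⟨ cong (ℕ._+ r) 1+B+j≡i ⟩
      i ℕ.+ r               ≡⟨ i+r≡n ⟩
      n                     ∎
      where open ≡-Reasoning
    j<B : j ℕ.< B
    j<B = ℕ.+-cancelˡ-< B j B (ℕ.≤-trans (ℕ.≤-reflexive 1+B+j≡i) (ℕ.≤-trans i≤n n≤2B))
    j≤2+c : j ℕ.≤ 2 ℕ.+ (B ℕ.+ r)
    j≤2+c = ℕ.m≤n⇒m≤o+n 2 (ℕ.m≤n⇒m≤n+o r (ℕ.<⇒≤ j<B))

  slack : ℕ → ℤ
  slack i = + 2 * G i - D * s (suc n) i

  slack-step : ∀ i → slack i ≡ slack (suc i) + (+ 2 * + suc n) * (slope i - h)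
  slack-step i = begin
    + 2 * G i - D * s (suc n) i
      ≡⟨ cong₂ (λ g t → + 2 * g - D * t) (G-step i) (s-suc (suc n) i) ⟩
    + 2 * (G (suc i) + + suc n * slope i) - D * (s (suc n) (suc i) + + 2)
      ≡⟨ regroup (G (suc i)) (+ suc n) (slope i) h (s (suc n) (suc i)) ⟩
    slack (suc i) + (+ 2 * + suc n) * (slope i - h) ∎
    where
    open ≡-Reasoning
    regroup : ∀ g d x h t →
              + 2 * (g + d * x) - (d * h) * (t + + 2) ≡ (+ 2 * g - (d * h) * t) + (+ 2 * d) * (x - h)
    regroup = solve-∀

  slack-descends : ∀ {i} → i ℕ.< suc B → slack (suc i) ℤ.≤ slack i
  slack-descends {i} (s≤s i≤B) = begin
    slack (suc i)                         ≡⟨ ℤ.+-identityʳ _ ⟨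
    slack (suc i) + 0ℤ                    ≡⟨ cong (ℤ._+_ (slack (suc i))) (ℤ.*-zeroʳ k) ⟨
    slack (suc i) + k * 0ℤ
      ≤⟨ ℤ.+-monoʳ-≤ (slack (suc i)) (ℤ.*-monoˡ-≤-nonNeg k (ℤ.i≤j⇒0≤j-i (h≤slope i≤B))) ⟩
    slack (suc i) + k * (slope i - h)     ≡⟨ slack-step i ⟨
    slack i                               ∎
    where
    open ℤ.≤-Reasoning
    k = + 2 * + suc n

  slack-ascends : n ℕ.≤ B ℕ.+ B → ∀ {i} → suc B ℕ.≤ i → i ℕ.< suc n → slack i ℤ.≤ slack (suc i)
  slack-ascends n≤2B {i} 1+B≤i (s≤s i≤n) = begin
    slack i                               ≡⟨ slack-step i ⟩
    slack (suc i) + k * (slope i - h)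
      ≤⟨ ℤ.+-monoʳ-≤ (slack (suc i)) (ℤ.*-monoˡ-≤-nonNeg k (ℤ.i≤j⇒i-j≤0 (slope≤h n≤2B 1+B≤i i≤n))) ⟩
    slack (suc i) + k * 0ℤ                ≡⟨ cong (ℤ._+_ (slack (suc i))) (ℤ.*-zeroʳ k) ⟩
    slack (suc i) + 0ℤ                    ≡⟨ ℤ.+-identityʳ _ ⟩
    slack (suc i)                         ∎
    where
    open ℤ.≤-Reasoning
    k = + 2 * + suc n

  slack-at-bottom : n ℕ.≤ B ℕ.+ B → 0ℤ ℤ.≤ slack (suc B)
  slack-at-bottom n≤2B = subst (0ℤ ℤ.≤_) (sym slack≡) (ℤ.+-mono-≤ 0≤2G 0≤D[2B-n])
    where
    0≤h : 0ℤ ℤ.≤ h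
    0≤h = esym-nonNeg m (countdown-nonNeg {n} {n} (ℕ.n≤1+n n))
    0≤G : 0ℤ ℤ.≤ G (suc B)
    0≤G = subst (λ y → 0ℤ ℤ.≤ esym (suc m) (countdown y (suc n))) (sym start-suc-B)
                (esym-nonNeg (suc m) (countdown-nonNeg {n} {suc n} ℕ.≤-refl))
    0≤2G : 0ℤ ℤ.≤ + 2 * G (suc B)
    0≤2G = *-nonNeg (+ 2) (G (suc B)) (+≤+ z≤n) 0≤G
    0≤D[2B-n] : 0ℤ ℤ.≤ D * (+ (B ℕ.+ B) - + n)
    0≤D[2B-n] = *-nonNeg _ _ (*-nonNeg (+ suc n) h (+≤+ z≤n) 0≤h) (ℤ.i≤j⇒0≤j-i (+≤+ n≤2B))
    regroup : ∀ g D n b → + 2 * g - D * ((1ℤ + n - + 2 * (1ℤ + b)) + 1ℤ) ≡ + 2 * g + D * ((b + b) - n)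
    regroup = solve-∀
    slack≡ : slack (suc B) ≡ + 2 * G (suc B) + D * (+ (B ℕ.+ B) - + n)
    slack≡ = trans (cong (λ t → + 2 * G (suc B) - D * ((+ suc n - t) + 1ℤ)) (ℤ.pos-* 2 (suc B)))
                   (regroup (G (suc B)) D (+ n) (+ B))

  D*s≤2G : n ℕ.≤ B ℕ.+ B → ∀ {i} → i ℕ.≤ suc n → D * s (suc n) i ℤ.≤ + 2 * G i
  D*s≤2G n≤2B i≤d = ℤ.0≤i-j⇒j≤i
    (ℤ.≤-trans (slack-at-bottom n≤2B) (valley-bottom-≤ slack slack-descends (slack-ascends n≤2B) i≤d))

  D-pos : m ℕ.≤ n → 0ℤ ℤ.< D
  D-pos m≤n = subst (ℤ._< D) (ℤ.*-zeroʳ (+ suc n)) (ℤ.*-monoˡ-<-pos (+ suc n) 0<h)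
    where
    0<h : 0ℤ ℤ.< h
    0<h = esym-pos m (countdown-pos ℕ.≤-refl) (subst (m ℕ.≤_) (sym (length-countdown (+ n) n)) m≤n)

toℚᵘ-/ : ∀ a p → toℚᵘ (a / suc p) ℚᵘ.≃ mkℚᵘ a p
toℚᵘ-/ a p = ℚ.toℚᵘ-fromℚᵘ (mkℚᵘ a p)

/-*-/ : ∀ a b p q → (a / suc p) ℚ.* (b / suc q) ≡ (a * b) / (suc p ℕ.* suc q)
/-*-/ a b p q = ℚ.toℚᵘ-injective (ℚᵘ.≃-trans (ℚ.toℚᵘ-homo-* (a / suc p) (b / suc q))
  (ℚᵘ.≃-trans (ℚᵘ.*-cong (toℚᵘ-/ a p) (toℚᵘ-/ b q)) (ℚᵘ.≃-sym (toℚᵘ-/ (a * b) (q ℕ.+ p ℕ.* suc q)))))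

/≤/ : ∀ a b p q → a * + suc q ℤ.≤ b * + suc p → a / suc p ℚ.≤ b / suc q
/≤/ a b p q aq≤bp = ℚ.toℚᵘ-cancel-≤
  (ℚᵘ.≤-respˡ-≃ (ℚᵘ.≃-sym (toℚᵘ-/ a p)) (ℚᵘ.≤-respʳ-≃ (ℚᵘ.≃-sym (toℚᵘ-/ b q)) (*≤* aq≤bp)))

0</ : ∀ a p → 0ℤ ℤ.< a → 0ℚ ℚ.< a / suc p
0</ (+ zero)  p (+<+ ())
0</ (+ suc a) p _ = ℚ.positive⁻¹ (+ suc a / suc p) {{ℚ.normalize-pos (suc a) (suc p)}}

/2*/1≤/1 : ∀ a t b → a * t ℤ.≤ + 2 * b → (a / 2) ℚ.* (t / 1) ≤ℚ b / 1
/2*/1≤/1 a t b at≤2b = subst (_≤ℚ b / 1) (sym (/-*-/ a t 1 0))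
  (/≤/ (a * t) b 1 0 (subst₂ ℤ._≤_ (sym (ℤ.*-identityʳ (a * t))) (ℤ.*-comm (+ 2) b) at≤2b))

n≤⌈n/2⌉+⌈n/2⌉ : ∀ n → n ℕ.≤ ℕ.⌈ n /2⌉ ℕ.+ ℕ.⌈ n /2⌉
n≤⌈n/2⌉+⌈n/2⌉ n = ℕ.≤-trans (ℕ.≤-reflexive (sym (ℕ.⌊n/2⌋+⌈n/2⌉≡n n))) (ℕ.+-monoˡ-≤ _ (ℕ.⌊n/2⌋≤⌈n/2⌉ n))

module Specialised {n ℓ : ℕ} (ℓ≤n : ℓ ℕ.≤ n) where

  open RunSums n (n ℕ.∸ ℓ) (B (suc n)) public

  d∸ℓ≡1+m : suc n ℕ.∸ ℓ ≡ suc (n ℕ.∸ ℓ)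
  d∸ℓ≡1+m = ℕ.+-∸-assoc 1 ℓ≤n

  g≡G : ∀ i → g (suc n) ℓ i ≡ G i
  g≡G i = trans (sumProdSubsets≡esym (λ k → start i - + k) (suc n ℕ.∸ ℓ) (upTo (suc n)))
    (cong₂ esym d∸ℓ≡1+m (trans (List.map-upTo _ (suc n)) (applyUpTo-countdown (start i) (suc n) _ (λ _ → refl))))

  lam≡D/2 : lam (suc n) ℓ ≡ D / 2
  lam≡D/2 = begin
    ½ ℚ.* ((g (suc n) ℓ (B (suc n)) - g (suc n) ℓ (suc (B (suc n)))) / 1)
      ≡⟨ cong (λ x → ½ ℚ.* (x / 1)) (trans (cong₂ _-_ (g≡G (B (suc n))) (g≡G (suc (B (suc n))))) G-drop) ⟩
    ½ ℚ.* (D / 1)     ≡⟨ /-*-/ 1ℤ D 1 0 ⟩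
    (1ℤ * D) / 2      ≡⟨ ℚ./-cong (ℤ.*-identityˡ D) refl ⟩
    D / 2             ∎
    where open ≡-Reasoning

  rhs-sum≡h : sumProdSubsets (λ k → + suc n - + k) (suc n ℕ.∸ ℓ ℕ.∸ 1) (drop 1 (upTo (suc n))) ≡ h
  rhs-sum≡h = trans (sumProdSubsets≡esym (λ k → + suc n - + k) (suc n ℕ.∸ ℓ ℕ.∸ 1) (drop 1 (upTo (suc n))))
    (cong₂ esym (cong (ℕ._∸ 1) d∸ℓ≡1+m)
                (trans (List.map-applyUpTo suc _ n) (applyUpTo-countdown (+ n) n _ (λ k → cancel (+ n) (+ k)))))
    where
    cancel : ∀ n k → (1ℤ + n) - (1ℤ + k) ≡ n - k
    cancel = solve-∀

  rhs≡D/2 : rhs (suc n) ℓ ≡ D / 2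
  rhs≡D/2 = trans (cong (λ x → (+ suc n / 2) ℚ.* (x / 1)) rhs-sum≡h) (/-*-/ (+ suc n) h 1 0)

lemma4p6 : (d ℓ : ℕ) → 1 ≤ d → ℓ < d →
    (lam d ℓ ≡ rhs d ℓ) × (0ℚ <ℚ lam d ℓ) ×
    ((i : ℕ) → i ≤ d → lam d ℓ ℚ.* (s d i / 1) ≤ℚ (g d ℓ i / 1))
lemma4p6 (suc n) ℓ _ (s≤s ℓ≤n) = trans lam≡D/2 (sym rhs≡D/2) , 0<lam , lam*s≤g
  where
  open Specialised ℓ≤n
  0<lam : 0ℚ <ℚ lam (suc n) ℓ
  0<lam = subst (0ℚ <ℚ_) (sym lam≡D/2) (0</ D 1 (D-pos (ℕ.m∸n≤m n ℓ)))
  lam*s≤g : (i : ℕ) → i ≤ suc n → lam (suc n) ℓ ℚ.* (s (suc n) i / 1) ≤ℚ (g (suc n) ℓ i / 1)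
  lam*s≤g i i≤d = subst₂ _≤ℚ_ (cong (ℚ._* (s (suc n) i / 1)) (sym lam≡D/2)) (cong (_/ 1) (sym (g≡G i)))
                         (/2*/1≤/1 D (s (suc n) i) (G i) (D*s≤2G (n≤⌈n/2⌉+⌈n/2⌉ n) i≤d))
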